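{- Let $G=(V,E)$ be a cocomparability graph, let $\sigma$ be an LDFS umbrella-free ordering of $V$, let $\sigma'$ be an arbitrary induced subordering of $\sigma$, and let $\sigma''$ be any LDFS closure of $\sigma'$ within $\sigma$. Then the rightmost vertex of $\sigma'$ is also the rightmost vertex of $\sigma''$.
   Context: Graphs are finite, simple, undirected. An ordering $\sigma$ of a vertex set is umbrella-free if for all $x<_\sigma y<_\sigma z$, $xz\in E$ implies $xy\in E$ or $yz\in E$. For an ordering $\sigma$ of the vertices of a graph, a triple $(a,b,c)$ with $a<_\sigma b<_\sigma c$, $ac\in E$, $ab\notin E$ is good if there is a vertex $d$ (in the ordering) with $a<_\sigma d<_\sigma b$, $db\in E$, $dc\notin E$, and bad otherwise; $\sigma$ is an LDFS ordering if it has no bad triple. An induced subordering of $\sigma$ is the restriction of $\sigma$ to a subset of the vertices (as an ordering of the induced subgraph). An LDFS closure of an induced subordering $\sigma'$ of $\sigma$ (within $\sigma$) is an induced subordering $\sigma''$ of $\sigma$ with the smallest number of vertices such that $\sigma''$ contains all vertices of $\sigma'$ and $\sigma''$ is an LDFS ordering. -}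

module Defs where

open import Level using (0ℓ)
open import Data.Nat using (ℕ; _≤_)
open import Data.Fin using (Fin)
open import Data.List using (List; []; _∷_; _++_; length)
open import Data.List.Membership.Propositional using (_∈_)
open import Data.List.Relation.Unary.Unique.Propositional using (Unique)
open import Data.List.Relation.Binary.Sublist.Propositional using (_⊆_)
open import Data.Product using (Σ; ∃; _×_; _,_)
open import Data.Sum using (_⊎_)
open import Relation.Nullary using (¬_)
open import Relation.Binary.PropositionalEquality using (_≡_; _≢_)

record Graph (n : ℕ) : Set₁ where
  field
    E     : Fin n → Fin n → Set
    sym   : ∀ {u v} → E u v → E v u
    irrefl : ∀ {u} → ¬ E u u
open Graph public

Before : ∀ {n} → List (Fin n) → Fin n → Fin n → Set
Before τ x y = Σ (List _) λ xs → Σ (List _) λ ys → (τ ≡ xs ++ (x ∷ ys)) × (y ∈ ys)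

IsOrderingOf : ∀ {n} → List (Fin n) → Set
IsOrderingOf σ = Unique σ × (∀ v → v ∈ σ)

-- Complement of G is a comparability graph (has a transitive orientation).
IsCocomparability : ∀ {n} → Graph n → Set₁
IsCocomparability {n} G =
  Σ (Fin n → Fin n → Set) λ R →
    (∀ u v → u ≢ v → ¬ E G u v → R u v ⊎ R v u)
  × (∀ u v → R u v → (u ≢ v) × ¬ E G u v)
  × (∀ u v → R u v → ¬ R v u)
  × (∀ u v w → R u v → R v w → R u w)

UmbrellaFree : ∀ {n} → Graph n → List (Fin n) → Set
UmbrellaFree G σ = ∀ x y z → Before σ x y → Before σ y z → E G x z → E G x y ⊎ E G y z

-- A triple (a,b,c) of τ with a<b<c, ac ∈ E, ab ∉ E is good if there is d
-- with a<d<b, db ∈ E, dc ∉ E.  LDFS = no bad triple.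
IsLDFS : ∀ {n} → Graph n → List (Fin n) → Set
IsLDFS G τ = ∀ a b c → Before τ a b → Before τ b c → E G a c → ¬ E G a b →
  ∃ λ d → Before τ a d × Before τ d b × E G d b × ¬ E G d c

-- Induced subordering of σ: a sublist of σ.
-- LDFS closure of σ' within σ: an induced subordering σ'' of σ containing all
-- vertices of σ', LDFS, and of minimum size among all such.
IsLDFSClosure : ∀ {n} → Graph n → List (Fin n) → List (Fin n) → List (Fin n) → Set
IsLDFSClosure G σ σ' σ'' =
  (σ'' ⊆ σ) × (∀ v → v ∈ σ' → v ∈ σ'') × IsLDFS G σ''
  × (∀ τ → τ ⊆ σ → (∀ v → v ∈ σ' → v ∈ τ) → IsLDFS G τ → length σ'' ≤ length τ)

-- A prefix of a duplicate-free LDFS ordering is again LDFS: the witness d of a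
-- triple (a,b,c) lies between a and b, so it survives cutting the ordering after b.
-- Let v be the rightmost vertex of σ'. Every vertex of σ' precedes v in σ, hence
-- precedes v in σ'' as well, so the prefix of σ'' ending at v is an LDFS induced
-- subordering of σ containing σ'. By minimality of σ'' it is all of σ''.
module Submission where

open import Level using (Level)
open import Defs hiding (sym)
open import Data.Nat using (ℕ; _≤_)
open import Data.Nat.Properties using (≤-antisym)
open import Data.Fin using (Fin)
open import Data.List using (List; []; _∷_; _++_; [_]; last; length; initLast; _∷ʳ′_)
open import Data.List.Properties using (++-assoc)
open import Data.List.Membership.Propositional using (_∈_)
open import Data.List.Membership.Propositional.Properties using (∈-++⁺ˡ; ∈-++⁺ʳ; ∈-++⁻; ∈-∃++)
open import Data.List.Relation.Unary.Any using (here; there)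
open import Data.List.Relation.Unary.AllPairs using (_∷_)
open import Data.List.Relation.Unary.Unique.Propositional using (Unique)
open import Data.List.Relation.Unary.Unique.Propositional.Properties using (Unique[x∷xs]⇒x∉xs)
open import Data.List.Relation.Binary.Equality.Propositional using (≋⇒≡)
open import Data.List.Relation.Binary.Sublist.Propositional
  using (_⊆_; []; _∷_; _∷ʳ_; ⊆-refl; ⊆-trans; minimum)
open import Data.List.Relation.Binary.Sublist.Propositional.Properties
  using (All-resp-⊆; Any-resp-⊆; ++⁺; length-mono-≤; to-≋)
open import Data.Maybe using (just)
open import Data.Product using (_×_; _,_)
open import Data.Sum using (_⊎_; inj₁; inj₂)
open import Data.Empty using (⊥-elim)
open import Relation.Nullary using (¬_)
open import Relation.Binary.PropositionalEquality using (_≡_; refl; sym; trans; subst)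

private
  variable
    a : Level
    A : Set a
    n : ℕ
    u v w x y : Fin n
    xs ys τ ρ σ : List (Fin n)

Unique-resp-⊇ : {xs ys : List A} → xs ⊆ ys → Unique ys → Unique xs
Unique-resp-⊇ []         u          = u
Unique-resp-⊇ (_ ∷ʳ p)   (_ ∷ u)    = Unique-resp-⊇ p u
Unique-resp-⊇ (refl ∷ p) (x∉ ∷ u)   = All-resp-⊆ p x∉ ∷ Unique-resp-⊇ p u

⊆∧length-≥⇒≡ : {xs ys : List A} → xs ⊆ ys → length ys ≤ length xs → xs ≡ ys
⊆∧length-≥⇒≡ p le = ≋⇒≡ (to-≋ (≤-antisym (length-mono-≤ p) le) p)

last-∷ʳ : (xs : List A) (v : A) → last (xs ++ [ v ]) ≡ just v
last-∷ʳ []           v = refl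
last-∷ʳ (_ ∷ [])     v = refl
last-∷ʳ (_ ∷ y ∷ xs) v = last-∷ʳ (y ∷ xs) v

Before⇒∈ˡ : Before τ x y → x ∈ τ
Before⇒∈ˡ (xs , _ , refl , _) = ∈-++⁺ʳ xs (here refl)

Before⇒∈ʳ : Before τ x y → y ∈ τ
Before⇒∈ʳ (xs , _ , refl , y∈) = ∈-++⁺ʳ xs (there y∈)

¬Before-[] : ¬ Before {n} [] x y
¬Before-[] ([]    , _ , () , _)
¬Before-[] (_ ∷ _ , _ , () , _)

Before-head : y ∈ τ → Before (x ∷ τ) x y
Before-head {τ = τ} y∈ = [] , τ , refl , y∈

Before-∷ : Before τ x y → Before (u ∷ τ) x y
Before-∷ {u = u} (xs , ys , refl , y∈) = u ∷ xs , ys , refl , y∈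

Before-∷⁻ : Before (u ∷ τ) x y → (x ≡ u × y ∈ τ) ⊎ Before τ x y
Before-∷⁻ ([]     , _  , refl , y∈) = inj₁ (refl , y∈)
Before-∷⁻ (_ ∷ xs , ys , refl , y∈) = inj₂ (xs , ys , refl , y∈)

Before-∷ʳ : x ∈ xs → Before (xs ++ [ v ]) x v
Before-∷ʳ {v = v} x∈ with ∈-∃++ x∈
... | as , bs , refl = as , bs ++ [ v ] , ++-assoc as (_ ∷ bs) [ v ] , ∈-++⁺ʳ bs (here refl)

Before-++ʳ : ∀ ρ → Before τ x y → Before (τ ++ ρ) x y
Before-++ʳ ρ (xs , ys , refl , y∈) = xs , ys ++ ρ , ++-assoc xs (_ ∷ ys) ρ , ∈-++⁺ˡ y∈

Before-⊆ : τ ⊆ σ → Before τ x y → Before σ x y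
Before-⊆ []         b = ⊥-elim (¬Before-[] b)
Before-⊆ (_ ∷ʳ p)   b = Before-∷ (Before-⊆ p b)
Before-⊆ (refl ∷ p) b with Before-∷⁻ b
... | inj₁ (refl , y∈) = Before-head (Any-resp-⊆ p y∈)
... | inj₂ b′          = Before-∷ (Before-⊆ p b′)

Before-asym : Unique τ → Before τ x y → ¬ Before τ y x
Before-asym {τ = []}    _ b _ = ¬Before-[] b
Before-asym {τ = _ ∷ _} u@(_ ∷ u′) b b′ with Before-∷⁻ b | Before-∷⁻ b′
... | inj₁ (refl , y∈) | inj₁ (refl , _) = Unique[x∷xs]⇒x∉xs u y∈
... | inj₁ (refl , _)  | inj₂ c          = Unique[x∷xs]⇒x∉xs u (Before⇒∈ʳ c)
... | inj₂ c           | inj₁ (refl , _) = Unique[x∷xs]⇒x∉xs u (Before⇒∈ʳ c)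
... | inj₂ c           | inj₂ c′         = Before-asym u′ c c′

Before-++⁻ : ∀ τ → Unique (τ ++ ρ) → Before (τ ++ ρ) x y → y ∈ τ → Before τ x y
Before-++⁻ (_ ∷ τ) u@(_ ∷ u′) b y∈ with Before-∷⁻ b | y∈
... | inj₁ (refl , y∈τρ) | here refl = ⊥-elim (Unique[x∷xs]⇒x∉xs u y∈τρ)
... | inj₁ (refl , _)    | there y∈τ = Before-head y∈τ
... | inj₂ c             | here refl = ⊥-elim (Unique[x∷xs]⇒x∉xs u (Before⇒∈ʳ c))
... | inj₂ c             | there y∈τ = Before-∷ (Before-++⁻ τ u′ c y∈τ)

IsLDFS-[] : (G : Graph n) → IsLDFS G []
IsLDFS-[] G a b c ab = ⊥-elim (¬Before-[] ab)

IsLDFS-++⁻ : (G : Graph n) (τ : List (Fin n)) →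
  Unique (τ ++ ρ) → IsLDFS G (τ ++ ρ) → IsLDFS G τ
IsLDFS-++⁻ {ρ = ρ} G τ u ldfs a b c ab bc ac ¬ab
  with ldfs a b c (Before-++ʳ ρ ab) (Before-++ʳ ρ bc) ac ¬ab
... | d , ad , db , edb , ¬dc = d , ad′ , db′ , edb , ¬dc
  where
    db′ : Before τ d b
    db′ = Before-++⁻ τ u db (Before⇒∈ˡ bc)
    ad′ : Before τ a d
    ad′ = Before-++⁻ τ u ad (Before⇒∈ˡ db′)

Before⇒∈-prefix : ∀ p q → Unique σ → (p ++ v ∷ q) ⊆ σ →
  w ∈ p ++ v ∷ q → Before σ w v → w ∈ p
Before⇒∈-prefix p q uσ s w∈ wv with ∈-++⁻ p w∈
... | inj₁ w∈p         = w∈p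
... | inj₂ (here refl) = ⊥-elim (Before-asym uσ wv wv)
... | inj₂ (there w∈q) = ⊥-elim (Before-asym uσ wv (Before-⊆ s (p , q , refl , w∈q)))

LDFSClosure-last : (G : Graph n) → Unique σ → (xs ++ [ v ]) ⊆ σ →
  ∀ σ'' → IsLDFSClosure G σ (xs ++ [ v ]) σ'' → last σ'' ≡ just v
LDFSClosure-last {n = n} {xs = xs} {v = v} G uσ σ'⊆σ σ'' (σ''⊆σ , σ'∈σ'' , ldfs , minimal)
  with ∈-∃++ (σ'∈σ'' v (∈-++⁺ʳ xs (here refl)))
... | p , q , refl = subst (λ l → last l ≡ just v) prefix≡σ'' (last-∷ʳ p v)
  where
    prefix : List (Fin n)
    prefix = p ++ [ v ]

    σ''≡prefix++q : p ++ v ∷ q ≡ prefix ++ q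
    σ''≡prefix++q = sym (++-assoc p [ v ] q)

    prefix⊆σ'' : prefix ⊆ p ++ v ∷ q
    prefix⊆σ'' = ++⁺ ⊆-refl (refl ∷ minimum q)

    prefix-LDFS : IsLDFS G prefix
    prefix-LDFS = IsLDFS-++⁻ G prefix (subst Unique σ''≡prefix++q (Unique-resp-⊇ σ''⊆σ uσ))
                            (subst (IsLDFS G) σ''≡prefix++q ldfs)

    σ'∈prefix : ∀ w → w ∈ xs ++ [ v ] → w ∈ prefix
    σ'∈prefix w w∈ with ∈-++⁻ xs w∈
    ... | inj₂ (here refl) = ∈-++⁺ʳ p (here refl)
    ... | inj₁ w∈xs = ∈-++⁺ˡ (Before⇒∈-prefix p q uσ σ''⊆σ (σ'∈σ'' w w∈)
                                (Before-⊆ σ'⊆σ (Before-∷ʳ w∈xs)))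

    prefix≡σ'' : prefix ≡ p ++ v ∷ q
    prefix≡σ'' = ⊆∧length-≥⇒≡ prefix⊆σ''
      (minimal prefix (⊆-trans prefix⊆σ'' σ''⊆σ) σ'∈prefix prefix-LDFS)

corollary1 : ∀ {n} (G : Graph n) → IsCocomparability G →
    (σ : List (Fin n)) → IsOrderingOf σ → IsLDFS G σ → UmbrellaFree G σ →
    (σ' : List (Fin n)) → σ' ⊆ σ →
    (σ'' : List (Fin n)) → IsLDFSClosure G σ σ' σ'' →
    last σ'' ≡ last σ'
corollary1 G _ σ (uσ , _) _ _ σ' σ'⊆σ σ'' closure@(_ , _ , _ , minimal) with initLast σ'
... | [] with σ'' | minimal [] (minimum σ) (λ _ ()) (IsLDFS-[] G)
...   | []    | _  = refl
...   | _ ∷ _ | ()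
corollary1 G _ σ (uσ , _) _ _ σ' σ'⊆σ σ'' closure | xs ∷ʳ′ v =
  trans (LDFSClosure-last G uσ σ'⊆σ σ'' closure) (sym (last-∷ʳ xs v))
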